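{- Let $U_S$ be the s(ASP) universe, and let $X$ be a negatively constrained variable whose prohibited value list is a finite list $t_1,\dots,t_k$ ($k\ge 0$) of terms, none of which is a variable and none of which contains a negatively constrained variable. Then: (1) $X$ is not constrained against every element of $U_S$; (2) $X$ is not empty with respect to $U_S$, i.e. there is an element of $U_S$ to which $X$ may be bound; (3) the domain of $X$ with respect to $U_S$ (the set of elements of $U_S$ that do not unify with any $t_i$) is infinite.
   Context: The Herbrand universe of a program is the set of ground terms built from its constants and function symbols. The s(ASP) universe $U_S$ is an infinite proper superset of the Herbrand universe, obtained by extending the language with an infinite set of new special constants (in the manner of Shoenfield); these new constants occur in no program and in no term of a prohibited value list. A negatively constrained variable is a variable associated with a prohibited value list (a finite list of prohibited values, each of which is a non-variable, possibly non-ground term); it represents the set of all values in the universe that are not in this list, i.e. that do not unify with any element of the list. An unbound variable is the special case with empty prohibited value list. A variable is empty with respect to a domain $D$ if its prohibited value list excludes every element of $D$. In the paper's legal programs, a negatively constrained variable is never disunified with or constrained against another negatively constrained variable, so prohibited value lists never contain negatively constrained variables. -}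

module Defs where

open import Data.Nat using (ℕ)
open import Data.Empty using (⊥)
open import Data.Vec using (Vec; []; _∷_)
open import Data.List using (List)
open import Data.List.Relation.Unary.Any using (Any)
open import Data.List.Relation.Unary.All using (All)
open import Data.Product using (Σ; ∃; _×_)
open import Relation.Nullary using (¬_)
open import Relation.Binary.PropositionalEquality using (_≡_)

record Signature : Set₁ where
  field
    Sym   : Set
    arity : Sym → ℕ
open Signature public

module _ (Σg : Signature) where

  -- Terms over the extended language: program function symbols, the
  -- infinitely many new special constants (indexed by ℕ, à la Shoenfield),
  -- and variables drawn from V.
  data Term (V : Set) : Set where
    var  : V → Term V
    fn   : (f : Sym Σg) → Vec (Term V) (arity Σg f) → Term V
    spec : ℕ → Term V

  US : Set
  US = Term ⊥

  PTerm : Set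
  PTerm = Term ℕ

  mutual
    NoSpecial : {V : Set} → Term V → Set
    NoSpecial (var x)   = Data.Unit.⊤
      where import Data.Unit
    NoSpecial (fn f ts) = NoSpecialVec ts
    NoSpecial (spec n)  = ⊥

    NoSpecialVec : {V : Set} {n : ℕ} → Vec (Term V) n → Set
    NoSpecialVec []       = Data.Unit.⊤
      where import Data.Unit
    NoSpecialVec (t ∷ ts) = NoSpecial t × NoSpecialVec ts

  NonVar : {V : Set} → Term V → Set
  NonVar (var x)   = ⊥
  NonVar (fn f ts) = Data.Unit.⊤
    where import Data.Unit
  NonVar (spec n)  = Data.Unit.⊤
    where import Data.Unit

  -- Admissible prohibited value: a non-variable term occurring in a program
  -- (no special constants); its variables are ordinary variables (never
  -- negatively constrained ones).
  Admissible : PTerm → Set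
  Admissible t = NonVar t × NoSpecial t

  mutual
    _⟦_⟧ : PTerm → (ℕ → US) → US
    var x    ⟦ σ ⟧ = σ x
    fn f ts  ⟦ σ ⟧ = fn f (ts ⟦ σ ⟧ᵛ)
    spec n   ⟦ σ ⟧ = spec n

    _⟦_⟧ᵛ : {n : ℕ} → Vec PTerm n → (ℕ → US) → Vec US n
    []       ⟦ σ ⟧ᵛ = []
    (t ∷ ts) ⟦ σ ⟧ᵛ = (t ⟦ σ ⟧) ∷ (ts ⟦ σ ⟧ᵛ)

  Unifies : US → PTerm → Set
  Unifies u t = Σ (ℕ → US) λ σ → t ⟦ σ ⟧ ≡ u

  -- A negatively constrained variable is represented by its prohibited
  -- value list. u is excluded (X is constrained against u) iff u unifies
  -- with some prohibited value.
  ConstrainedAgainst : List PTerm → US → Set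
  ConstrainedAgainst pvl u = Any (Unifies u) pvl

  ConstrainedAgainstAll : List PTerm → Set
  ConstrainedAgainstAll pvl = (u : US) → ConstrainedAgainst pvl u

  InDomain : List PTerm → US → Set
  InDomain pvl u = All (λ t → ¬ Unifies u t) pvl

  EmptyWrtUS : List PTerm → Set
  EmptyWrtUS pvl = (u : US) → ¬ InDomain pvl u

  InfiniteDomain : List PTerm → Set
  InfiniteDomain pvl =
    Σ (ℕ → US) λ g → ((n : ℕ) → InDomain pvl (g n))
                   × ((m n : ℕ) → g m ≡ g n → m ≡ n)

module Submission where

-- A prohibited value is a non-variable term of the program's language, so
-- each of its instances is headed by a program function symbol or is the
-- term itself; none is a fresh special constant. Hence every special
-- constant lies in the domain of X, and n ↦ spec n embeds ℕ into it.

open import Defs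
open import Data.Nat using (ℕ)
open import Data.List using (List)
open import Data.List.Relation.Unary.All as All using (All)
open import Data.List.Relation.Unary.All.Properties using (All¬⇒¬Any)
open import Data.Product using (Σ; _×_; _,_)
open import Relation.Nullary using (¬_)
open import Relation.Binary.PropositionalEquality using (_≡_; refl)

module _ {Σg : Signature} where

  spec-injective : (m n : ℕ) → _≡_ {A = US Σg} (spec m) (spec n) → m ≡ n
  spec-injective m n refl = refl

  spec-¬unifies-admissible : ∀ n {t} → Admissible Σg t → ¬ Unifies Σg (spec n) t
  spec-¬unifies-admissible n {var x}    (() , _)
  spec-¬unifies-admissible n {fn f ts}  _        (σ , ())
  spec-¬unifies-admissible n {spec m}   (_ , ())

  spec-inDomain : ∀ n {pvl} → All (Admissible Σg) pvl → InDomain Σg pvl (spec n)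
  spec-inDomain n = All.map (spec-¬unifies-admissible n)

  inDomain⇒¬constrainedAgainstAll : ∀ {pvl u} → InDomain Σg pvl u → ¬ ConstrainedAgainstAll Σg pvl
  inDomain⇒¬constrainedAgainstAll u∈dom against = All¬⇒¬Any u∈dom (against _)

  inDomain⇒¬emptyWrtUS : ∀ {pvl u} → InDomain Σg pvl u → ¬ EmptyWrtUS Σg pvl
  inDomain⇒¬emptyWrtUS u∈dom empty = empty _ u∈dom

proposition3p4 : (Σg : Signature) (pvl : List (PTerm Σg)) → All (Admissible Σg) pvl →
    (¬ ConstrainedAgainstAll Σg pvl)
    × ((¬ EmptyWrtUS Σg pvl) × Σ (US Σg) (InDomain Σg pvl))
    × InfiniteDomain Σg pvl
proposition3p4 Σg pvl adm =
    inDomain⇒¬constrainedAgainstAll spec0∈dom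
  , (inDomain⇒¬emptyWrtUS spec0∈dom , (spec 0 , spec0∈dom))
  , (spec , (λ n → spec-inDomain n adm) , spec-injective)
  where
  spec0∈dom : InDomain Σg pvl (spec 0)
  spec0∈dom = spec-inDomain 0 adm
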